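{- Let $S$ be a string over an alphabet $\Sigma$ and let $w$ be a repeat in $S$. If $\phi_S(w) \geq 1$, then $w \in \mathsf{M}(S)$, i.e., $w$ is a maximal repeat of $S$.
   Context: For strings $w,S$, $\mathrm{occ}_S(w) = |\{i \mid S[i..i+|w|-1] = w\}|$ is the number of occurrences of $w$ in $S$. A repeat in $S$ is a string $w$ with $\mathrm{occ}_S(w)\ge 2$. For a repeat $w$ of $S$, $\Phi_S(w) = \{(\alpha,\beta)\in\Sigma\times\Sigma \mid \mathrm{occ}_S(\alpha w\beta)=\mathrm{occ}_S(\alpha w)=\mathrm{occ}_S(w\beta)=1\}$ and the net frequency is $\phi_S(w)=|\Phi_S(w)|$. A repeat $w$ is left-maximal in $S$ if $w$ is a prefix of $S$ or there are two distinct characters $\alpha\neq\alpha'$ with $\alpha w$ and $\alpha' w$ both substrings of $S$; it is right-maximal if $w$ is a suffix of $S$ or there are two distinct characters $\beta\ne\beta'$ with $w\beta$ and $w\beta'$ both substrings of $S$. $\mathsf{M}(S)$ is the set of repeats of $S$ that are both left-maximal and right-maximal (maximal repeats). -}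

module Defs where

open import Data.Nat using (ℕ; zero; suc; _+_; _≥_; _≟_)
open import Data.Fin using (Fin)
open import Data.Fin.Properties as FinP using ()
open import Data.List using (List; []; _∷_; _++_; length; sum; map; filter; allFin; cartesianProduct)
open import Data.Product using (_×_; _,_; ∃; Σ)
open import Relation.Nullary using (¬_; Dec; yes; no)
open import Relation.Nullary.Decidable using (_×-dec_)
open import Relation.Binary.PropositionalEquality using (_≡_; _≢_)

Str : ℕ → Set
Str σ = List (Fin σ)

IsPrefix : ∀ {σ} → Str σ → Str σ → Set
IsPrefix w S = ∃ λ u → S ≡ w ++ u

IsSuffix : ∀ {σ} → Str σ → Str σ → Set
IsSuffix w S = ∃ λ u → S ≡ u ++ w

isPrefix? : ∀ {σ} (w S : Str σ) → Dec (IsPrefix w S)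
isPrefix? [] S = yes (S , _≡_.refl)
isPrefix? (x ∷ w) [] = no λ { (_ , ()) }
isPrefix? (x ∷ w) (y ∷ S) with x FinP.≟ y | isPrefix? w S
... | yes _≡_.refl | yes (u , e) = yes (u , Relation.Binary.PropositionalEquality.cong (x ∷_) e)
... | yes _≡_.refl | no ¬p = no λ { (u , _≡_.refl) → ¬p (u , _≡_.refl) }
... | no x≢y | _ = no λ { (u , _≡_.refl) → x≢y _≡_.refl }

-- occ_S(w) = number of positions i (0 ≤ i ≤ |S| - |w|) with S[i..i+|w|-1] = w,
-- i.e. the number of suffixes of S having w as a prefix.
-- (For w = [] this counts |S| + 1 positions; the statement only concerns repeats.)
occ : ∀ {σ} → Str σ → Str σ → ℕ
occ w [] with isPrefix? w []
... | yes _ = 1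
... | no _ = 0
occ w (x ∷ S) with isPrefix? w (x ∷ S)
... | yes _ = suc (occ w S)
... | no _ = occ w S

IsSubstring : ∀ {σ} → Str σ → Str σ → Set
IsSubstring w S = occ w S ≥ 1

IsRepeat : ∀ {σ} → Str σ → Str σ → Set
IsRepeat w S = occ w S ≥ 2

InΦ : ∀ {σ} → Str σ → Str σ → Fin σ × Fin σ → Set
InΦ S w (α , β) =
  (occ (α ∷ w ++ β ∷ []) S ≡ 1) × (occ (α ∷ w) S ≡ 1) × (occ (w ++ β ∷ []) S ≡ 1)

inΦ? : ∀ {σ} (S w : Str σ) (p : Fin σ × Fin σ) → Dec (InΦ S w p)
inΦ? S w (α , β) =
  (occ (α ∷ w ++ β ∷ []) S ≟ 1) ×-dec ((occ (α ∷ w) S ≟ 1) ×-dec (occ (w ++ β ∷ []) S ≟ 1))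

Φ : ∀ {σ} → Str σ → Str σ → List (Fin σ × Fin σ)
Φ {σ} S w = filter (inΦ? S w) (cartesianProduct (allFin σ) (allFin σ))

φ : ∀ {σ} → Str σ → Str σ → ℕ
φ S w = length (Φ S w)

LeftMaximal : ∀ {σ} → Str σ → Str σ → Set
LeftMaximal {σ} S w =
  IsPrefix w S ⊎′ Σ (Fin σ) λ α → Σ (Fin σ) λ α′ →
    (α ≢ α′) × IsSubstring (α ∷ w) S × IsSubstring (α′ ∷ w) S
  where open import Data.Sum using () renaming (_⊎_ to _⊎′_)

RightMaximal : ∀ {σ} → Str σ → Str σ → Set
RightMaximal {σ} S w =
  IsSuffix w S ⊎′ Σ (Fin σ) λ β → Σ (Fin σ) λ β′ →
    (β ≢ β′) × IsSubstring (w ++ β ∷ []) S × IsSubstring (w ++ β′ ∷ []) S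
  where open import Data.Sum using () renaming (_⊎_ to _⊎′_)

IsMaximalRepeat : ∀ {σ} → Str σ → Str σ → Set
IsMaximalRepeat S w = IsRepeat w S × LeftMaximal S w × RightMaximal S w

-- Let (α , β) ∈ Φ_S(w).  Since w occurs at least twice but α w only once, some
-- occurrence of w is either at the start of S or preceded by a character other
-- than α, so w is left-maximal; symmetrically, some occurrence of w is either at
-- the end of S or followed by a character other than β, so w is right-maximal.
module Submission where

open import Defs
open import Data.Nat using (ℕ; suc; _≤_; _<_; _≥_; z≤n; s≤s; s<s⁻¹)
open import Data.Nat.Properties using (≤-trans; ≤-refl; ≤-reflexive; n≤1+n; <-≤-trans; ≤-<-trans; <-irrefl)
open import Data.Fin using (Fin)
open import Data.Fin.Properties using (_≟_)
open import Data.List using (List; []; _∷_; _++_; length; allFin; cartesianProduct)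
open import Data.List.Properties using (++-assoc; ++-identityʳ)
open import Data.List.Membership.Propositional using (_∈_)
open import Data.List.Membership.Propositional.Properties using (∈-filter⁻)
open import Data.List.Relation.Unary.Any using (here)
open import Data.Product using (_×_; _,_; ∃; Σ; proj₂)
open import Data.Sum using (_⊎_; inj₁; inj₂)
open import Data.Empty using (⊥-elim)
open import Relation.Nullary using (¬_; Dec; yes; no)
open import Relation.Binary.PropositionalEquality using (_≡_; _≢_; refl; sym; trans; cong; subst₂; ≢-sym)

private
  variable
    σ : ℕ
    x : Fin σ
    S : Str σ

occ-[]-¬prefix : ∀ (v : Str σ) → ¬ IsPrefix v [] → occ v [] ≡ 0
occ-[]-¬prefix v ¬p with isPrefix? v []
... | yes p = ⊥-elim (¬p p)
... | no _  = refl

occ-[]-prefix : ∀ (v : Str σ) → IsPrefix v [] → occ v [] ≡ 1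
occ-[]-prefix v p with isPrefix? v []
... | yes _ = refl
... | no ¬p = ⊥-elim (¬p p)

occ-∷-prefix : ∀ (v : Str σ) x S → IsPrefix v (x ∷ S) → occ v (x ∷ S) ≡ suc (occ v S)
occ-∷-prefix v x S p with isPrefix? v (x ∷ S)
... | yes _ = refl
... | no ¬p = ⊥-elim (¬p p)

occ-∷-¬prefix : ∀ (v : Str σ) x S → ¬ IsPrefix v (x ∷ S) → occ v (x ∷ S) ≡ occ v S
occ-∷-¬prefix v x S ¬p with isPrefix? v (x ∷ S)
... | yes p = ⊥-elim (¬p p)
... | no _  = refl

occ-≤-∷ : ∀ (v : Str σ) x S → occ v S ≤ occ v (x ∷ S)
occ-≤-∷ v x S with isPrefix? v (x ∷ S)
... | yes _ = n≤1+n _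
... | no _  = ≤-refl

prefix⇒substring : ∀ (v S : Str σ) → IsPrefix v S → IsSubstring v S
prefix⇒substring v []      p = ≤-reflexive (sym (occ-[]-prefix v p))
prefix⇒substring v (x ∷ S) p = ≤-trans (s≤s z≤n) (≤-reflexive (sym (occ-∷-prefix v x S p)))

substring-∷ : ∀ (v : Str σ) → IsSubstring v S → IsSubstring v (x ∷ S)
substring-∷ v o = ≤-trans o (occ-≤-∷ v _ _)

∷-prefix : ∀ (w : Str σ) → IsPrefix w S → IsPrefix (x ∷ w) (x ∷ S)
∷-prefix w (u , eq) = u , cong (_ ∷_) eq

∷-suffix : ∀ (w : Str σ) → IsSuffix w S → IsSuffix w (x ∷ S)
∷-suffix w (u , eq) = _ ∷ u , cong (_ ∷_) eq

-- occ w S counts exactly the occurrences of w in x ∷ S that are preceded by a character.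
-- The decision of IsPrefix w S is an argument so that matching on it does not
-- with-abstract the occurrence of isPrefix? w S inside occ (α′ ∷ w) (x ∷ S).
other-left-extension : ∀ (w : Str σ) α x S → Dec (IsPrefix w S) → occ (α ∷ w) (x ∷ S) < occ w S →
                       Σ (Fin σ) λ α′ → α′ ≢ α × IsSubstring (α′ ∷ w) (x ∷ S)
other-left-extension w α x S (yes p) h with x ≟ α
... | no x≢α = x , x≢α , prefix⇒substring (x ∷ w) (x ∷ S) (∷-prefix w p)
other-left-extension w α α [] (yes p) h | yes refl =
  ⊥-elim (<-irrefl refl (≤-<-trans (prefix⇒substring (α ∷ w) (α ∷ []) (∷-prefix w p))
                                   (<-≤-trans h (≤-reflexive (occ-[]-prefix w p)))))
other-left-extension w α α (y ∷ S) (yes p) h | yes refl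
  with α′ , α′≢α , o ← other-left-extension w α y S (isPrefix? w S)
         (s<s⁻¹ (subst₂ _<_ (occ-∷-prefix (α ∷ w) α (y ∷ S) (∷-prefix w p)) (occ-∷-prefix w y S p) h))
  = α′ , α′≢α , substring-∷ (α′ ∷ w) o
other-left-extension w α x [] (no ¬p) h
  with () ← <-≤-trans h (≤-reflexive (occ-[]-¬prefix w ¬p))
other-left-extension w α x (y ∷ S) (no ¬p) h
  with α′ , α′≢α , o ← other-left-extension w α y S (isPrefix? w S)
         (<-≤-trans (s≤s (occ-≤-∷ (α ∷ w) x (y ∷ S))) (≤-trans h (≤-reflexive (occ-∷-¬prefix w y S ¬p))))
  = α′ , α′≢α , substring-∷ (α′ ∷ w) o

left-maximal : ∀ (S w : Str σ) α → IsRepeat w S → occ (α ∷ w) S ≡ 1 → LeftMaximal S w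
left-maximal S w α rep once with isPrefix? w S
... | yes p = inj₁ p
left-maximal [] w α rep once | no ¬p
  with () ← ≤-trans rep (≤-reflexive (occ-[]-¬prefix w ¬p))
left-maximal (x ∷ S) w α rep once | no ¬p
  with α′ , α′≢α , o ← other-left-extension w α x S (isPrefix? w S)
         (≤-trans (s≤s (≤-reflexive once)) (≤-trans rep (≤-reflexive (occ-∷-¬prefix w x S ¬p))))
  = inj₂ (α , α′ , ≢-sym α′≢α , ≤-reflexive (sym once) , o)

SuffixOrOtherRightExtension : Str σ → Fin σ → Str σ → Set
SuffixOrOtherRightExtension {σ} w β S =
  IsSuffix w S ⊎ (Σ (Fin σ) λ β′ → β′ ≢ β × IsSubstring (w ++ β′ ∷ []) S)

suffixOrOtherRightExtension-∷ : ∀ (w : Str σ) β →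
  SuffixOrOtherRightExtension w β S → SuffixOrOtherRightExtension w β (x ∷ S)
suffixOrOtherRightExtension-∷ w β (inj₁ s)                = inj₁ (∷-suffix w s)
suffixOrOtherRightExtension-∷ w β (inj₂ (β′ , β′≢β , o)) = inj₂ (β′ , β′≢β , substring-∷ (w ++ β′ ∷ []) o)

prefix-without-extension : ∀ (w S : Str σ) β → IsPrefix w S → ¬ IsPrefix (w ++ β ∷ []) S →
                           SuffixOrOtherRightExtension w β S
prefix-without-extension w S β ([] , eq) _ = inj₁ ([] , trans eq (++-identityʳ w))
prefix-without-extension w S β (b ∷ u , eq) ¬q with b ≟ β
... | yes refl = ⊥-elim (¬q (u , trans eq (sym (++-assoc w (b ∷ []) u))))
... | no b≢β   = inj₂ (b , b≢β , prefix⇒substring (w ++ b ∷ []) S (u , trans eq (sym (++-assoc w (b ∷ []) u))))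

extension-prefix⇒prefix : ∀ (w S : Str σ) β → IsPrefix (w ++ β ∷ []) S → IsPrefix w S
extension-prefix⇒prefix w S β (u , eq) = β ∷ u , trans eq (++-assoc w (β ∷ []) u)

¬extension-prefix-[] : ∀ (w : Str σ) β → ¬ IsPrefix (w ++ β ∷ []) []
¬extension-prefix-[] []      β (_ , ())
¬extension-prefix-[] (_ ∷ _) β (_ , ())

other-right-extension : ∀ (w S : Str σ) β → occ (w ++ β ∷ []) S < occ w S →
                        SuffixOrOtherRightExtension w β S
other-right-extension w S β h with isPrefix? (w ++ β ∷ []) S | isPrefix? w S
... | no ¬q | yes p = prefix-without-extension w S β p ¬q
... | yes q | no ¬p = ⊥-elim (¬p (extension-prefix⇒prefix w S β q))
other-right-extension w [] β h | yes q | yes _ = ⊥-elim (¬extension-prefix-[] w β q)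
other-right-extension w [] β h | no _ | no ¬p
  with () ← <-≤-trans h (≤-reflexive (occ-[]-¬prefix w ¬p))
other-right-extension w (x ∷ S) β h | yes q | yes p =
  suffixOrOtherRightExtension-∷ w β (other-right-extension w S β
    (s<s⁻¹ (subst₂ _<_ (occ-∷-prefix (w ++ β ∷ []) x S q) (occ-∷-prefix w x S p) h)))
other-right-extension w (x ∷ S) β h | no ¬q | no ¬p =
  suffixOrOtherRightExtension-∷ w β (other-right-extension w S β
    (subst₂ _<_ (occ-∷-¬prefix (w ++ β ∷ []) x S ¬q) (occ-∷-¬prefix w x S ¬p) h))

right-maximal : ∀ (S w : Str σ) β → IsRepeat w S → occ (w ++ β ∷ []) S ≡ 1 → RightMaximal S w
right-maximal S w β rep once with other-right-extension w S β (≤-trans (s≤s (≤-reflexive once)) rep)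
... | inj₁ s                = inj₁ s
... | inj₂ (β′ , β′≢β , o) = inj₂ (β , β′ , ≢-sym β′≢β , ≤-reflexive (sym once) , o)

element-of-nonempty : ∀ {A : Set} (xs : List A) → length xs ≥ 1 → ∃ (_∈ xs)
element-of-nonempty (x ∷ _) _ = x , here refl

Φ-element : ∀ (S w : Str σ) → φ S w ≥ 1 → Σ (Fin σ × Fin σ) (InΦ S w)
Φ-element {σ} S w φ≥1 with p , p∈Φ ← element-of-nonempty (Φ S w) φ≥1 =
  p , proj₂ (∈-filter⁻ (inΦ? S w) {xs = cartesianProduct (allFin σ) (allFin σ)} p∈Φ)

lemma1 : ∀ {σ : ℕ} (S w : Str σ) → IsRepeat w S → φ S w ≥ 1 → IsMaximalRepeat S w
lemma1 S w rep φ≥1 with (α , β) , _ , αw-once , wβ-once ← Φ-element S w φ≥1 =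
  rep , left-maximal S w α rep αw-once , right-maximal S w β rep wβ-once
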